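{- The subspace of $\textsf{ParSym}$ spanned by $\{\textsf{H}_\pi : \pi \text{ a matching}\}$ is a Hopf subalgebra of $\textsf{ParSym}$: it contains $\textsf{H}_\varnothing$, is closed under the product, $\Delta$ maps it into its tensor square, and the antipode $S$ maps it into itself.
   Context: Partition diagrams of order $k$ are set partitions of $\{1,\ldots,k,1',\ldots,k'\}$; $A_0=\{\varnothing\}$. A matching is a partition diagram all of whose blocks have size at most two. For $\pi$ of order $k$, $\rho$ of order $l$: $\pi\otimes\rho$ has as blocks those of $\pi$ and those of $\rho$ shifted ($i\mapsto i+k$, $i'\mapsto(i+k)'$). A diagram is $\otimes$-irreducible if it is not $\rho^{(1)}\otimes\rho^{(2)}$ with both factors nonempty. For nonempty $\pi,\rho$ (orders $k,l$), $\pi\bullet\rho$ is obtained from $\pi\otimes\rho$ by merging the block containing $k'$ with the block containing $(k+1)'$; $\varnothing\bullet\rho=\rho$, $\pi\bullet\varnothing=\pi$. Over a field $\mathbbm{k}$, $\textsf{ParSym}$ has basis $\{\textsf{H}_\pi\}$ over all partition diagrams, product $\textsf{H}_\pi\textsf{H}_\rho=\textsf{H}_{\pi\otimes\rho}$, unit $\textsf{H}_\varnothing$ (free on $\textsf{H}_\pi$, $\pi$ nonempty $\otimes$-irreducible). $\Delta$ is the algebra morphism with $\Delta\textsf{H}_\varnothing=\textsf{H}_\varnothing\otimes\textsf{H}_\varnothing$ and $\Delta\textsf{H}_\pi=\sum\textsf{H}_{G_1}\otimes\textsf{H}_{G_2}$ for nonempty $\otimes$-irreducible $\pi$, over ordered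 pairs $(G_1,G_2)$, each $\varnothing$ or $\otimes$-irreducible, with $G_1\bullet G_2=\pi$. $S$ is the linear antimorphism with $S(\textsf{H}_\varnothing)=\textsf{H}_\varnothing$ and $S(\textsf{H}_\pi)=\sum(-1)^\ell\textsf{H}_{\rho^{(1)}}\cdots\textsf{H}_{\rho^{(\ell)}}$ for nonempty $\otimes$-irreducible $\pi$, over tuples of nonempty diagrams with $\rho^{(1)}\bullet\cdots\bullet\rho^{(\ell)}=\pi$. -}

module Defs where

open import Level using (Level; _⊔_)
open import Data.Bool using (Bool; true; false; if_then_else_; _∧_; _∨_; not)
open import Data.Nat using (ℕ; zero; suc; _+_; _∸_; _≡ᵇ_; _≤_)
open import Data.List using (List; []; _∷_; _++_; map; concatMap; upTo; foldr; length; zip)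
open import Data.Bool.ListAction using (all; any)
open import Data.Vec using (Vec; toList; take; drop) renaming (_++_ to _++ᵛ_; map to mapᵛ; [] to []ᵛ; _∷_ to _∷ᵛ_)
open import Data.Product using (_×_; _,_; Σ)
open import Data.List.Relation.Unary.All using (All)
open import Relation.Nullary using (¬_)
open import Algebra.Bundles using (CommutativeRing)

record Field (c ℓ : Level) : Set (Level.suc (c ⊔ ℓ)) where
  field
    commutativeRing : CommutativeRing c ℓ
  open CommutativeRing commutativeRing public
  field
    1≉0     : ¬ (1# ≈ 0#)
    inverse : ∀ x → ¬ (x ≈ 0#) → Σ Carrier (λ y → x * y ≈ 1#)

-- A diagram of order k is given by a labelling of its 2k points:
-- top i = label of point i (i = 1..k), bot i = label of point i'.
-- Two points lie in the same block iff they carry the same label.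
-- Two labellings represent the same partition diagram iff they have the
-- same order and induce the same equivalence relation on the points
-- (see _≐_ below); all notions below respect this.

record Diagram : Set where
  constructor diag
  field
    order : ℕ
    top   : Vec ℕ order
    bot   : Vec ℕ order
open Diagram public

labels : Diagram → List ℕ
labels π = toList (top π) ++ toList (bot π)

∅ : Diagram
∅ = diag 0 []ᵛ []ᵛ

sameRel : List (ℕ × ℕ) → Bool
sameRel ps = all (λ { (a , a') → all (λ { (b , b') → eqB (a ≡ᵇ b) (a' ≡ᵇ b') }) ps }) ps
  where
  eqB : Bool → Bool → Bool
  eqB true  y = y
  eqB false y = not y

_≐_ : Diagram → Diagram → Bool
π ≐ ρ = (order π ≡ᵇ order ρ) ∧ sameRel (zip (labels π) (labels ρ))

occ : ℕ → List ℕ → ℕ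
occ x []       = 0
occ x (y ∷ ys) = if x ≡ᵇ y then suc (occ x ys) else occ x ys

Matching : Diagram → Set
Matching π = All (λ x → occ x (labels π) ≤ 2) (labels π)

fresh : Diagram → ℕ
fresh π = suc (foldr _+_ 0 (labels π))

_⊗_ : Diagram → Diagram → Diagram
π ⊗ ρ = diag (order π + order ρ)
              (top π ++ᵛ mapᵛ (N +_) (top ρ))
              (bot π ++ᵛ mapᵛ (N +_) (bot ρ))
  where N = fresh π

lastOr : List ℕ → ℕ
lastOr []           = 0
lastOr (x ∷ [])     = x
lastOr (x ∷ y ∷ ys) = lastOr (y ∷ ys)

headOr : List ℕ → ℕ
headOr []      = 0
headOr (x ∷ _) = x

-- π • ρ : merge the block of k' with the block of (k+1)' in π ⊗ ρ
_•_ : Diagram → Diagram → Diagram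
π • ρ with order π | order ρ
... | zero  | _     = ρ
... | suc _ | zero  = π
... | suc _ | suc _ = diag (order πρ) (mapᵛ relabel (top πρ)) (mapᵛ relabel (bot πρ))
  where
  πρ = π ⊗ ρ
  a  = lastOr (toList (bot π))
  b  = fresh π + headOr (toList (bot ρ))
  relabel : ℕ → ℕ
  relabel x = if x ≡ᵇ b then a else x

-- Enumeration of all partition diagrams of order n (each exactly once):
-- restricted growth strings of length n + n.

rgs : (m : ℕ) → ℕ → List (Vec ℕ m)
rgs zero    c = []ᵛ ∷ []
rgs (suc m) c = concatMap (λ x → map (x ∷ᵛ_) (rgs m (if x ≡ᵇ c then suc c else c))) (upTo (suc c))

diagrams : ℕ → List Diagram
diagrams n = map (λ v → diag n (take n v) (drop n v)) (rgs (n + n) 0)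

reducible : Diagram → Bool
reducible π =
  any (λ j → any (λ ρ₁ → any (λ ρ₂ → (ρ₁ ⊗ ρ₂) ≐ π) (diagrams (order π ∸ suc j)))
                 (diagrams (suc j)))
      (upTo (order π ∸ 1))

irreducible : Diagram → Bool
irreducible π = not (reducible π)

isEmpty : Diagram → Bool
isEmpty π = order π ≡ᵇ 0

-- factorisation of a diagram into nonempty ⊗-irreducible factors
-- (split off the shortest nonempty left factor; fuel = order)
factorsF : ℕ → Diagram → List Diagram
factorsF zero     π = []
factorsF (suc f) π = go (upTo (order π ∸ 1))
  where
  firstSplit : ℕ → List (Diagram × Diagram)
  firstSplit j = concatMap (λ ρ₁ → concatMap (λ ρ₂ → if (ρ₁ ⊗ ρ₂) ≐ π then (ρ₁ , ρ₂) ∷ [] else [])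
                                      (diagrams (order π ∸ suc j)))
                           (diagrams (suc j))
  go : List ℕ → List Diagram
  go []       = π ∷ []
  go (j ∷ js) with firstSplit j
  ... | []              = go js
  ... | (ρ₁ , ρ₂) ∷ _   = ρ₁ ∷ factorsF f ρ₂

factors : Diagram → List Diagram
factors π = factorsF (order π) π

compositions : ℕ → List (List ℕ)
compositions zero          = [] ∷ []
compositions (suc zero)    = (1 ∷ []) ∷ []
compositions (suc (suc n)) =
  concatMap (λ { [] → [] ; (a ∷ c) → (suc a ∷ c) ∷ (1 ∷ a ∷ c) ∷ [] }) (compositions (suc n))

tuples : List ℕ → List (List Diagram)
tuples []       = [] ∷ []
tuples (l ∷ ls) = concatMap (λ ρ → map (ρ ∷_) (tuples ls)) (diagrams l)

-- ParSym over a field 𝕜: elements are finite formal linear combinations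
-- Σ cᵢ H_{πᵢ}, represented as lists of (coefficient, diagram); the
-- coefficient of H_σ is obtained with coeff.

module ParSym {c ℓ : Level} (𝕜 : Field c ℓ) where
  open Field 𝕜 renaming (_+_ to _+𝕜_; _*_ to _*𝕜_; -_ to -𝕜_)

  PS : Set c
  PS = List (Carrier × Diagram)

  PS⊗PS : Set c
  PS⊗PS = List (Carrier × Diagram × Diagram)

  H : Diagram → PS
  H π = (1# , π) ∷ []

  coeff : PS → Diagram → Carrier
  coeff x σ = foldr (λ { (a , π) s → if π ≐ σ then a +𝕜 s else s }) 0# x

  coeff₂ : PS⊗PS → Diagram → Diagram → Carrier
  coeff₂ x σ τ = foldr (λ { (a , π , ρ) s → if (π ≐ σ) ∧ (ρ ≐ τ) then a +𝕜 s else s }) 0# x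

  _·_ : PS → PS → PS
  x · y = concatMap (λ { (a , π) → map (λ { (b , ρ) → (a *𝕜 b , π ⊗ ρ) }) y }) x

  _·₂_ : PS⊗PS → PS⊗PS → PS⊗PS
  x ·₂ y = concatMap (λ { (a , π , π') → map (λ { (b , ρ , ρ') → (a *𝕜 b , π ⊗ ρ , π' ⊗ ρ') }) y }) x

  Δgen : Diagram → PS⊗PS
  Δgen π = concatMap (λ j → concatMap (λ G₁ → concatMap (λ G₂ →
              if (isEmpty G₁ ∨ irreducible G₁) ∧ (isEmpty G₂ ∨ irreducible G₂) ∧ ((G₁ • G₂) ≐ π)
              then (1# , G₁ , G₂) ∷ [] else [])
              (diagrams (order π ∸ j))) (diagrams j))
           (upTo (suc (order π)))

  -- Δ : algebra morphism, Δ H_∅ = H_∅ ⊗ H_∅, extended linearly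
  ΔH : Diagram → PS⊗PS
  ΔH π = foldr (λ ρ acc → Δgen ρ ·₂ acc) ((1# , ∅ , ∅) ∷ []) (factors π)

  Δ : PS → PS⊗PS
  Δ x = concatMap (λ { (a , π) → map (λ { (b , σ , τ) → (a *𝕜 b , σ , τ) }) (ΔH π) }) x

  sign : ℕ → Carrier
  sign zero    = 1#
  sign (suc n) = -𝕜 sign n

  Sgen : Diagram → PS
  Sgen π = concatMap (λ comp → concatMap (λ ρs →
              if foldr _•_ ∅ ρs ≐ π
              then (sign (length ρs) , foldr _⊗_ ∅ ρs) ∷ [] else [])
              (tuples comp))
           (compositions (order π))

  -- S : antimorphism, S H_∅ = H_∅, extended linearly
  SH : Diagram → PS
  SH π = foldr (λ ρ acc → acc · Sgen ρ) (H ∅) (factors π)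

  S : PS → PS
  S x = concatMap (λ { (a , π) → map (λ { (b , σ) → (a *𝕜 b , σ) }) (SH π) }) x

  InMatchingSpan : PS → Set ℓ
  InMatchingSpan x = ∀ σ → ¬ Matching σ → coeff x σ ≈ 0#

  InMatchingSpan² : PS⊗PS → Set ℓ
  InMatchingSpan² x = ∀ σ τ → ¬ (Matching σ × Matching τ) → coeff₂ x σ τ ≈ 0#

-- Coefficients in ParSym are read off up to relabelling of diagrams (≐), so x lies in the matching
-- span exactly when every non-matching ≐-class has total coefficient zero.  Hence a linear functional
-- that is constant on ≐-classes and vanishes on matchings vanishes on the whole span.  The product, Δ
-- and S are linear, depend only on the classes of their arguments, and send a matching to a combination
-- of (pairs of) matchings: ⊗ only juxtaposes blocks and • only merges two of them, so a ⊗-product of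
-- matchings is a matching, and every factor of a matching under ⊗ or • is a matching.
{-# OPTIONS --safe #-}
module Submission where

open import Defs
open import Algebra.Bundles using (Semiring)
open import Algebra.Properties.CommutativeSemigroup using (interchange)
open import Data.Bool using (Bool; true; false; if_then_else_; T; _∧_; _∨_)
open import Data.Bool.Properties using (T-≡; T-∧; T?; ∧-conicalˡ; ∧-conicalʳ)
open import Data.Empty using (⊥-elim)
open import Data.List using (List; []; _∷_; _++_; map; concatMap; foldr; length; zip; upTo)
open import Data.List.Properties
  using (map-++; length-++; length-map; ∷-injective; map-id; map-∘; concatMap-cong; foldr-map)
open import Data.List.Membership.Propositional using (_∈_; find)
open import Data.List.Relation.Binary.Subset.Propositional using (_⊆_)
open import Data.List.Relation.Unary.Any using (here; there)
open import Data.List.Relation.Unary.All using (All; []; _∷_; universal; all?)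
import Data.List.Relation.Unary.All as All
open import Data.List.Relation.Unary.All.Properties
  using (++⁺; ++⁻ˡ; ++⁻ʳ; map⁺; concat⁺; ¬Any⇒All¬; ¬All⇒Any¬; all⁺; all⁻)
open import Data.Nat using (ℕ; zero; suc; _∸_; _≡ᵇ_; _≤_; _<_; z≤n; s≤s; _<?_; _≤?_; _≟_)
open import Data.List.Membership.DecPropositional _≟_ using (_∈?_)
open import Data.Nat.Properties
  using ( ≡ᵇ⇒≡; ≡⇒≡ᵇ; ≤-refl; ≤-trans; m≤n⇒m≤1+n; m≤m+n; m≤n+m; +-cancelˡ-≡; <⇒≱; ≮⇒≥
        ; m+[n∸m]≡n; m+n≮m; m+n∸m≡n; suc-injective; module ≤-Reasoning)
import Data.Nat.Properties as ℕ
open import Data.Nat.ListAction using (sum)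
open import Data.Product using (_×_; _,_; ∃; Σ; proj₁; proj₂)
open import Data.Product.Relation.Binary.Pointwise.NonDependent using (Pointwise; ×-isEquivalence)
open import Data.Vec using (Vec; toList) renaming ([] to []ᵛ)
open import Data.Vec.Properties using (toList-map; toList-++; length-toList)
open import Function using (_∘_; id; case_of_; Equivalence)
open import Level using (Level)
open import Relation.Binary using (IsEquivalence; _Preserves_⟶_)
open import Relation.Binary.PropositionalEquality
  using (_≡_; _≢_; refl; sym; trans; cong; cong₂; subst; module ≡-Reasoning)
open import Relation.Nullary using (¬_; yes; no; contradiction)
open import Relation.Unary using (Decidable)

All-concatMap : ∀ {a b p} {A : Set a} {B : Set b} {P : B → Set p} (f : A → List B) →
                (∀ x → All P (f x)) → ∀ xs → All P (concatMap f xs)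
All-concatMap f h xs = concat⁺ (map⁺ (universal h xs))

All-guarded : ∀ {b p} {B : Set b} {P : B → Set p} c (y : B) → (c ≡ true → P y) →
              All P (if c then y ∷ [] else [])
All-guarded true  y h = h refl ∷ []
All-guarded false y h = []

record IsBooleanEquivalence {B : Set} (_∼_ : B → B → Set) (_∼ᵇ_ : B → B → Bool) : Set where
  field
    isEquivalence : IsEquivalence _∼_
    sound         : ∀ {π σ} → π ∼ᵇ σ ≡ true → π ∼ σ
    complete      : ∀ {π σ} → π ∼ σ → π ∼ᵇ σ ≡ true

  open IsEquivalence isEquivalence public renaming (refl to ∼-refl; sym to ∼-sym; trans to ∼-trans)

  ∼ᵇ-congˡ : ∀ {π π'} σ → π ∼ π' → (π ∼ᵇ σ) ≡ (π' ∼ᵇ σ)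
  ∼ᵇ-congˡ {π} {π'} σ π∼π' with π ∼ᵇ σ in e | π' ∼ᵇ σ in e'
  ... | true  | true  = refl
  ... | false | false = refl
  ... | true  | false = trans (sym (complete (∼-trans (∼-sym π∼π') (sound e)))) e'
  ... | false | true  = trans (sym e) (complete (∼-trans π∼π' (sound e')))

  ∼ᵇ-congʳ : ∀ π {σ σ'} → σ ∼ σ' → (π ∼ᵇ σ) ≡ (π ∼ᵇ σ')
  ∼ᵇ-congʳ π {σ} {σ'} σ∼σ' with π ∼ᵇ σ in e | π ∼ᵇ σ' in e'
  ... | true  | true  = refl
  ... | false | false = refl
  ... | true  | false = trans (sym (complete (∼-trans (sound e) σ∼σ'))) e'
  ... | false | true  = trans (sym e) (complete (∼-trans (sound e') (∼-sym σ∼σ')))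

module LinearCombinations {c ℓ} (R : Semiring c ℓ) where
  open Semiring R renaming (refl to ≈-refl; sym to ≈-sym; trans to ≈-trans)
  open import Algebra.Properties.CommutativeSemigroup +-commutativeSemigroup using (x∙yz≈y∙xz)
  open import Relation.Binary.Reasoning.Setoid setoid

  Combination : Set → Set c
  Combination B = List (Carrier × B)

  SupportedOn : {B : Set} → (B → Set) → Combination B → Set c
  SupportedOn P = All (P ∘ proj₂)

  weightedSum : {B : Set} → (B → Carrier) → Combination B → Carrier
  weightedSum f []            = 0#
  weightedSum f ((a , π) ∷ x) = a * f π + weightedSum f x

  coeffWith : {B : Set} → (B → B → Bool) → Combination B → B → Carrier
  coeffWith _∼ᵇ_ x σ = foldr (λ { (a , π) s → if π ∼ᵇ σ then a + s else s }) 0# x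

  indicator : Bool → Carrier
  indicator b = if b then 1# else 0#

  -- Bilinear extension, as in H_π H_ρ = H_{π ⊗ ρ}; x · y, Δ x and S x are all of this form.
  expand : {A B C : Set} → (A → Combination C) → (A → C → B) → Combination A → Combination B
  expand F g x = concatMap (λ { (a , π) → map (λ { (b , ρ) → (a * b , g π ρ) }) (F π) }) x

  module _ {B : Set} where

    weightedSum-cong : ∀ {f g : B → Carrier} → (∀ π → f π ≈ g π) → ∀ x →
                       weightedSum f x ≈ weightedSum g x
    weightedSum-cong f≈g []            = ≈-refl
    weightedSum-cong f≈g ((a , π) ∷ x) = +-cong (*-cong ≈-refl (f≈g π)) (weightedSum-cong f≈g x)

    weightedSum-++ : ∀ (f : B → Carrier) x y →
                     weightedSum f (x ++ y) ≈ weightedSum f x + weightedSum f y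
    weightedSum-++ f []            y = ≈-sym (+-identityˡ _)
    weightedSum-++ f ((a , π) ∷ x) y =
      ≈-trans (+-cong ≈-refl (weightedSum-++ f x y)) (≈-sym (+-assoc _ _ _))

    weightedSum-supported : ∀ {P : B → Set} (f : B → Carrier) → (∀ π → P π → f π ≈ 0#) →
                            ∀ x → SupportedOn P x → weightedSum f x ≈ 0#
    weightedSum-supported f f≈0 []            []         = ≈-refl
    weightedSum-supported f f≈0 ((a , π) ∷ x) (Pπ ∷ Px) = begin
      a * f π + weightedSum f x
        ≈⟨ +-cong (*-cong ≈-refl (f≈0 π Pπ)) (weightedSum-supported f f≈0 x Px) ⟩
      a * 0# + 0#               ≈⟨ +-identityʳ _ ⟩
      a * 0#                    ≈⟨ zeroʳ a ⟩
      0#                        ∎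

    coeff≈weightedSum : ∀ (_∼ᵇ_ : B → B → Bool) x σ →
                        coeffWith _∼ᵇ_ x σ ≈ weightedSum (λ π → indicator (π ∼ᵇ σ)) x
    coeff≈weightedSum _∼ᵇ_ []            σ = ≈-refl
    coeff≈weightedSum _∼ᵇ_ ((a , π) ∷ x) σ with π ∼ᵇ σ
    ... | true  = +-cong (≈-sym (*-identityʳ a)) (coeff≈weightedSum _∼ᵇ_ x σ)
    ... | false = begin
      coeffWith _∼ᵇ_ x σ       ≈⟨ coeff≈weightedSum _∼ᵇ_ x σ ⟩
      weightedSum _ x          ≈⟨ +-identityˡ _ ⟨
      0# + weightedSum _ x     ≈⟨ +-cong (zeroʳ a) ≈-refl ⟨
      a * 0# + weightedSum _ x ∎

  weightedSum-scale : ∀ {B C : Set} (f : B → Carrier) (g : C → B) a y →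
    weightedSum f (map (λ { (b , ρ) → (a * b , g ρ) }) y) ≈ a * weightedSum (f ∘ g) y
  weightedSum-scale f g a []            = ≈-sym (zeroʳ a)
  weightedSum-scale f g a ((b , ρ) ∷ y) = begin
    a * b * f (g ρ) + weightedSum f (map _ y)
      ≈⟨ +-cong (*-assoc a b _) (weightedSum-scale f g a y) ⟩
    a * (b * f (g ρ)) + a * weightedSum (f ∘ g) y  ≈⟨ distribˡ a _ _ ⟨
    a * (b * f (g ρ) + weightedSum (f ∘ g) y)      ∎

  weightedSum-expand : ∀ {A B C : Set} (f : B → Carrier) (F : A → Combination C) (g : A → C → B) x →
    weightedSum f (expand F g x) ≈ weightedSum (λ π → weightedSum (f ∘ g π) (F π)) x
  weightedSum-expand f F g []            = ≈-refl
  weightedSum-expand f F g ((a , π) ∷ x) = begin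
    weightedSum f (map _ (F π) ++ expand F g x)                 ≈⟨ weightedSum-++ f (map _ (F π)) _ ⟩
    weightedSum f (map _ (F π)) + weightedSum f (expand F g x)
      ≈⟨ +-cong (weightedSum-scale f (g π) a (F π)) (weightedSum-expand f F g x) ⟩
    a * weightedSum (f ∘ g π) (F π) + weightedSum _ x           ∎

  coeff-expand : ∀ {A B C : Set} (_∼ᵇ_ : B → B → Bool) (F : A → Combination C) (g : A → C → B) x σ →
    coeffWith _∼ᵇ_ (expand F g x) σ
      ≈ weightedSum (λ π → weightedSum (λ ρ → indicator (g π ρ ∼ᵇ σ)) (F π)) x
  coeff-expand _∼ᵇ_ F g x σ = ≈-trans (coeff≈weightedSum _∼ᵇ_ (expand F g x) σ)
                                      (weightedSum-expand (λ ρ → indicator (ρ ∼ᵇ σ)) F g x)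

  expand-supported : ∀ {A B C : Set} {P : A → Set} {Q : C → Set} {S : B → Set}
    (F : A → Combination C) (g : A → C → B) → (∀ {π ρ} → P π → Q ρ → S (g π ρ)) →
    (∀ π → P π → SupportedOn Q (F π)) → ∀ x → SupportedOn P x → SupportedOn S (expand F g x)
  expand-supported F g PQ⇒S FQ []            []         = []
  expand-supported F g PQ⇒S FQ ((a , π) ∷ x) (Pπ ∷ Px) =
    ++⁺ (map⁺ (All.map (λ {q} → PQ⇒S {π} {proj₂ q} Pπ) (FQ π Pπ)))
        (expand-supported F g PQ⇒S FQ x Px)

  module _ {B : Set} {_∼_ : B → B → Set} {_∼ᵇ_ : B → B → Bool}
           (isBoolEq : IsBooleanEquivalence _∼_ _∼ᵇ_) {P : B → Set} (P-resp : ∀ {π σ} → π ∼ σ → P π → P σ)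
           where

    indicator-vanishes : ∀ σ → ¬ P σ → ∀ π → P π → indicator (π ∼ᵇ σ) ≈ 0#
    indicator-vanishes σ ¬Pσ π Pπ with π ∼ᵇ σ in π∼σ
    ... | true  = ⊥-elim (¬Pσ (P-resp (IsBooleanEquivalence.sound isBoolEq π∼σ) Pπ))
    ... | false = ≈-refl

    coeff-supported : ∀ x σ → SupportedOn P x → ¬ P σ → coeffWith _∼ᵇ_ x σ ≈ 0#
    coeff-supported x σ Px ¬Pσ =
      ≈-trans (coeff≈weightedSum _∼ᵇ_ x σ)
              (weightedSum-supported _ (indicator-vanishes σ ¬Pσ) x Px)

  module Span {B : Set} {_∼_ : B → B → Set} {_∼ᵇ_ : B → B → Bool}
              (isBoolEq : IsBooleanEquivalence _∼_ _∼ᵇ_) where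

    open IsBooleanEquivalence isBoolEq

    coeff : Combination B → B → Carrier
    coeff = coeffWith _∼ᵇ_

    dropClass : B → Combination B → Combination B
    dropClass π []            = []
    dropClass π ((a , ρ) ∷ x) = if ρ ∼ᵇ π then dropClass π x else (a , ρ) ∷ dropClass π x

    weightedSum-dropClass : ∀ (f : B → Carrier) → f Preserves _∼_ ⟶ _≈_ → ∀ π x →
      weightedSum f x ≈ coeff x π * f π + weightedSum f (dropClass π x)
    weightedSum-dropClass f f-resp π []            = ≈-sym (≈-trans (+-identityʳ _) (zeroˡ (f π)))
    weightedSum-dropClass f f-resp π ((a , ρ) ∷ x) with ρ ∼ᵇ π in ρ∼π
    ... | true  = begin
      a * f ρ + weightedSum f x
        ≈⟨ +-cong (*-cong ≈-refl (f-resp (sound ρ∼π))) (weightedSum-dropClass f f-resp π x) ⟩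
      a * f π + (coeff x π * f π + weightedSum f (dropClass π x))
        ≈⟨ +-assoc _ _ _ ⟨
      (a * f π + coeff x π * f π) + weightedSum f (dropClass π x)
        ≈⟨ +-cong (distribʳ (f π) a _) ≈-refl ⟨
      (a + coeff x π) * f π + weightedSum f (dropClass π x)
        ∎
    ... | false = ≈-trans (+-cong ≈-refl (weightedSum-dropClass f f-resp π x)) (x∙yz≈y∙xz _ _ _)

    coeff-dropClass-∼ : ∀ {π σ} → π ∼ σ → ∀ x → coeff (dropClass π x) σ ≈ 0#
    coeff-dropClass-∼         π∼σ []            = ≈-refl
    coeff-dropClass-∼ {π} {σ} π∼σ ((a , ρ) ∷ x) with ρ ∼ᵇ π in ρ∼π
    ... | true  = coeff-dropClass-∼ π∼σ x
    ... | false rewrite sym (∼ᵇ-congʳ ρ π∼σ) | ρ∼π = coeff-dropClass-∼ π∼σ x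

    coeff-dropClass-≁ : ∀ {π σ} → π ∼ᵇ σ ≡ false → ∀ x → coeff (dropClass π x) σ ≈ coeff x σ
    coeff-dropClass-≁         π≁σ []            = ≈-refl
    coeff-dropClass-≁ {π} {σ} π≁σ ((a , ρ) ∷ x) with ρ ∼ᵇ π in ρ∼π
    ... | true rewrite ∼ᵇ-congˡ σ (sound ρ∼π) | π≁σ = coeff-dropClass-≁ π≁σ x
    ... | false with ρ ∼ᵇ σ
    ...   | true  = +-cong ≈-refl (coeff-dropClass-≁ π≁σ x)
    ...   | false = coeff-dropClass-≁ π≁σ x

    length-dropClass : ∀ π x → length (dropClass π x) ≤ length x
    length-dropClass π []            = z≤n
    length-dropClass π ((a , ρ) ∷ x) with ρ ∼ᵇ π
    ... | true  = m≤n⇒m≤1+n (length-dropClass π x)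
    ... | false = s≤s (length-dropClass π x)

    dropClass-head : ∀ π a x → dropClass π ((a , π) ∷ x) ≡ dropClass π x
    dropClass-head π a x rewrite complete (∼-refl {π}) = refl

    module _ {P : B → Set} (P? : Decidable P) where

      InSpan : Combination B → Set ℓ
      InSpan x = ∀ σ → ¬ P σ → coeff x σ ≈ 0#

      dropClass-inSpan : ∀ π x → InSpan x → InSpan (dropClass π x)
      dropClass-inSpan π x x∈ σ ¬Pσ with π ∼ᵇ σ in π∼σ
      ... | true  = coeff-dropClass-∼ (sound π∼σ) x
      ... | false = ≈-trans (coeff-dropClass-≁ π∼σ x) (x∈ σ ¬Pσ)

      -- Induction on a bound for the length: dropClass π x need not be a tail of x.
      weightedSum-inSpan-bounded : ∀ (f : B → Carrier) → f Preserves _∼_ ⟶ _≈_ →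
        (∀ π → P π → f π ≈ 0#) → ∀ n x → length x ≤ n → InSpan x → weightedSum f x ≈ 0#
      weightedSum-inSpan-bounded f f-resp f≈0 n       []               _           _  = ≈-refl
      weightedSum-inSpan-bounded f f-resp f≈0 (suc n) x@((a , π) ∷ x') (s≤s |x'|≤n) x∈ = begin
        weightedSum f x                                  ≈⟨ weightedSum-dropClass f f-resp π x ⟩
        coeff x π * f π + weightedSum f (dropClass π x)  ≈⟨ +-cong class≈0 rest≈0 ⟩
        0# + 0#                                          ≈⟨ +-identityˡ 0# ⟩
        0#                                               ∎
        where
        class≈0 : coeff x π * f π ≈ 0#
        class≈0 with P? π
        ... | yes Pπ = ≈-trans (*-cong ≈-refl (f≈0 π Pπ)) (zeroʳ _)
        ... | no ¬Pπ = ≈-trans (*-cong (x∈ π ¬Pπ) ≈-refl) (zeroˡ _)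
        rest≈0 : weightedSum f (dropClass π x) ≈ 0#
        rest≈0 rewrite dropClass-head π a x' =
          weightedSum-inSpan-bounded f f-resp f≈0 n (dropClass π x')
            (≤-trans (length-dropClass π x') |x'|≤n)
            (subst InSpan (dropClass-head π a x') (dropClass-inSpan π x x∈))

      weightedSum-inSpan : ∀ (f : B → Carrier) → f Preserves _∼_ ⟶ _≈_ →
        (∀ π → P π → f π ≈ 0#) → ∀ x → InSpan x → weightedSum f x ≈ 0#
      weightedSum-inSpan f f-resp f≈0 x = weightedSum-inSpan-bounded f f-resp f≈0 (length x) x ≤-refl

-- Imported only here because inside LinearCombinations _+_ is the semiring addition.
open import Data.Nat using (_+_)

≡ᵇ-sound : ∀ {m n} → (m ≡ᵇ n) ≡ true → m ≡ n
≡ᵇ-sound e = ≡ᵇ⇒≡ _ _ (Equivalence.from T-≡ e)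

≡ᵇ-complete : ∀ {m n} → m ≡ n → (m ≡ᵇ n) ≡ true
≡ᵇ-complete {m} {n} m≡n = Equivalence.to T-≡ (≡⇒≡ᵇ m n m≡n)

≡ᵇ-cong : ∀ {m n m' n'} → (m ≡ n → m' ≡ n') → (m' ≡ n' → m ≡ n) →
          (m ≡ᵇ n) ≡ (m' ≡ᵇ n')
≡ᵇ-cong {m} {n} {m'} {n'} to from with m ≡ᵇ n in e | m' ≡ᵇ n' in e'
... | true  | true  = refl
... | false | false = refl
... | true  | false = trans (sym (≡ᵇ-complete (to (≡ᵇ-sound e)))) e'
... | false | true  = trans (sym e) (≡ᵇ-complete (from (≡ᵇ-sound e')))

occ-++ : ∀ x xs ys → occ x (xs ++ ys) ≡ occ x xs + occ x ys
occ-++ x []       ys = refl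
occ-++ x (y ∷ xs) ys with x ≡ᵇ y
... | true  = cong suc (occ-++ x xs ys)
... | false = occ-++ x xs ys

occ-absent : ∀ {x} xs → All (x ≢_) xs → occ x xs ≡ 0
occ-absent         []       []          = refl
occ-absent {x} (y ∷ xs) (x≢y ∷ x∉xs) with x ≡ᵇ y in e
... | true  = contradiction (≡ᵇ-sound e) x≢y
... | false = occ-absent xs x∉xs

occ-map-≤ : ∀ (h : ℕ → ℕ) x xs → occ x xs ≤ occ (h x) (map h xs)
occ-map-≤ h x []       = z≤n
occ-map-≤ h x (y ∷ xs) with x ≡ᵇ y in e | h x ≡ᵇ h y in e'
... | true  | true  = s≤s (occ-map-≤ h x xs)
... | false | true  = m≤n⇒m≤1+n (occ-map-≤ h x xs)
... | false | false = occ-map-≤ h x xs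
... | true  | false = case trans (sym (≡ᵇ-complete (cong h (≡ᵇ-sound e)))) e' of λ ()

occ-map-injective : ∀ (h : ℕ → ℕ) → (∀ {a b} → h a ≡ h b → a ≡ b) → ∀ x xs →
                    occ (h x) (map h xs) ≡ occ x xs
occ-map-injective h inj x []       = refl
occ-map-injective h inj x (y ∷ xs) rewrite ≡ᵇ-cong (inj {x} {y}) (cong h) with x ≡ᵇ y
... | true  = cong suc (occ-map-injective h inj x xs)
... | false = occ-map-injective h inj x xs

AtMostTwice : List ℕ → Set
AtMostTwice xs = ∀ x → occ x xs ≤ 2

matching⇒atMostTwice : ∀ π → Matching π → AtMostTwice (labels π)
matching⇒atMostTwice π m x with x ∈? labels π
... | yes x∈ = All.lookup m x∈
... | no  x∉ = subst (_≤ 2) (sym (occ-absent (labels π) (¬Any⇒All¬ _ x∉))) z≤n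

atMostTwice⇒matching : ∀ π → AtMostTwice (labels π) → Matching π
atMostTwice⇒matching π m = universal m (labels π)

matching? : Decidable Matching
matching? π = all? (λ x → occ x (labels π) ≤? 2) (labels π)

atMostTwice-map⁻ : ∀ (h : ℕ → ℕ) xs → AtMostTwice (map h xs) → AtMostTwice xs
atMostTwice-map⁻ h xs m x = ≤-trans (occ-map-≤ h x xs) (m (h x))

labels<fresh : ∀ π → All (_< fresh π) (labels π)
labels<fresh π = All.map s≤s (elem≤sum (labels π))
  where
  elem≤sum : ∀ xs → All (_≤ sum xs) xs
  elem≤sum []       = []
  elem≤sum (x ∷ xs) = m≤m+n x (sum xs) ∷ All.map (λ y≤ → ≤-trans y≤ (m≤n+m _ x)) (elem≤sum xs)

labels-⊗ : ∀ π ρ → labels (π ⊗ ρ) ≡ (toList (top π) ++ map (fresh π +_) (toList (top ρ)))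
                                   ++ (toList (bot π) ++ map (fresh π +_) (toList (bot ρ)))
labels-⊗ π ρ = cong₂ _++_
  (trans (toList-++ (top π) _) (cong (toList (top π) ++_) (toList-map _ (top ρ))))
  (trans (toList-++ (bot π) _) (cong (toList (bot π) ++_) (toList-map _ (bot ρ))))

occ-labels-⊗ : ∀ π ρ x → occ x (labels (π ⊗ ρ)) ≡ occ x (labels π) + occ x (map (fresh π +_) (labels ρ))
occ-labels-⊗ π ρ x = begin
  occ x (labels (π ⊗ ρ))                             ≡⟨ cong (occ x) (labels-⊗ π ρ) ⟩
  occ x ((t ++ S u) ++ (b ++ S v))                   ≡⟨ occ-++ x (t ++ S u) _ ⟩
  occ x (t ++ S u) + occ x (b ++ S v)                ≡⟨ cong₂ _+_ (occ-++ x t _) (occ-++ x b _) ⟩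
  (occ x t + occ x (S u)) + (occ x b + occ x (S v))  ≡⟨ interchange ℕ.+-commutativeSemigroup (occ x t) _ _ _ ⟩
  (occ x t + occ x b) + (occ x (S u) + occ x (S v))  ≡⟨ cong₂ _+_ (occ-++ x t b) (occ-++ x (S u) _) ⟨
  occ x (t ++ b) + occ x (S u ++ S v)                ≡⟨ cong (λ l → occ x (t ++ b) + occ x l) (map-++ _ u v) ⟨
  occ x (labels π) + occ x (S (labels ρ))            ∎
  where
  open ≡-Reasoning
  S = map (fresh π +_)
  t = toList (top π)
  b = toList (bot π)
  u = toList (top ρ)
  v = toList (bot ρ)

matching-⊗⁻ : ∀ π ρ → Matching (π ⊗ ρ) → Matching π × Matching ρ
matching-⊗⁻ π ρ m = atMostTwice⇒matching π onπ , atMostTwice⇒matching ρ onρ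
  where
  open ≤-Reasoning
  N = fresh π
  S = map (N +_) (labels ρ)
  m' = matching⇒atMostTwice (π ⊗ ρ) m
  onπ : AtMostTwice (labels π)
  onπ x = begin
    occ x (labels π)                            ≤⟨ m≤m+n _ _ ⟩
    occ x (labels π) + occ x S                  ≡⟨ occ-labels-⊗ π ρ x ⟨
    occ x (labels (π ⊗ ρ))                      ≤⟨ m' x ⟩
    2                                           ∎
  onρ : AtMostTwice (labels ρ)
  onρ y = begin
    occ y (labels ρ)                            ≡⟨ occ-map-injective (N +_) (+-cancelˡ-≡ N _ _) y (labels ρ) ⟨
    occ (N + y) S                               ≤⟨ m≤n+m _ _ ⟩
    occ (N + y) (labels π) + occ (N + y) S      ≡⟨ occ-labels-⊗ π ρ (N + y) ⟨
    occ (N + y) (labels (π ⊗ ρ))                ≤⟨ m' (N + y) ⟩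
    2                                           ∎

matching-⊗⁺ : ∀ π ρ → Matching π → Matching ρ → Matching (π ⊗ ρ)
matching-⊗⁺ π ρ mπ mρ = atMostTwice⇒matching (π ⊗ ρ) onπ⊗ρ
  where
  open ≤-Reasoning
  N = fresh π
  S = map (N +_) (labels ρ)
  onπ⊗ρ : AtMostTwice (labels (π ⊗ ρ))
  onπ⊗ρ x with x <? N
  ... | yes x<N = begin
    occ x (labels (π ⊗ ρ))       ≡⟨ occ-labels-⊗ π ρ x ⟩
    occ x (labels π) + occ x S
      ≡⟨ cong (occ x (labels π) +_) (occ-absent S (map⁺ (universal x≢N+ (labels ρ)))) ⟩
    occ x (labels π) + 0         ≡⟨ ℕ.+-identityʳ _ ⟩
    occ x (labels π)             ≤⟨ matching⇒atMostTwice π mπ x ⟩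
    2                            ∎
    where
    x≢N+ : ∀ y → x ≢ N + y
    x≢N+ y x≡N+y = <⇒≱ x<N (subst (N ≤_) (sym x≡N+y) (m≤m+n N y))
  ... | no x≮N = begin
    occ x (labels (π ⊗ ρ))          ≡⟨ occ-labels-⊗ π ρ x ⟩
    occ x (labels π) + occ x S
      ≡⟨ cong (_+ occ x S) (occ-absent (labels π) (All.map x≢ (labels<fresh π))) ⟩
    occ x S                         ≡⟨ cong (λ z → occ z S) (m+[n∸m]≡n (≮⇒≥ x≮N)) ⟨
    occ (N + (x ∸ N)) S             ≡⟨ occ-map-injective (N +_) (+-cancelˡ-≡ N _ _) (x ∸ N) (labels ρ) ⟩
    occ (x ∸ N) (labels ρ)          ≤⟨ matching⇒atMostTwice ρ mρ (x ∸ N) ⟩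
    2                               ∎
    where
    x≢ : ∀ {y} → y < N → x ≢ y
    x≢ y<N x≡y = x≮N (subst (_< N) (sym x≡y) y<N)

matching-∅ : ∀ (t b : Vec ℕ 0) → Matching (diag 0 t b)
matching-∅ []ᵛ []ᵛ = []

labels-• : ∀ {k l} (t b : Vec ℕ (suc k)) (u v : Vec ℕ (suc l)) →
  let π = diag (suc k) t b ; ρ = diag (suc l) u v in ∃ λ r → labels (π • ρ) ≡ map r (labels (π ⊗ ρ))
labels-• t b u v = _ , trans (cong₂ _++_ (toList-map _ (top πρ)) (toList-map _ (bot πρ)))
                             (sym (map-++ _ (toList (top πρ)) (toList (bot πρ))))
  where πρ = diag _ t b ⊗ diag _ u v

matching-•⁻ : ∀ π ρ → Matching (π • ρ) → Matching π × Matching ρ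
matching-•⁻ (diag zero t b)    ρ                  m = matching-∅ t b , m
matching-•⁻ (diag (suc k) t b) (diag zero u v)    m = m , matching-∅ u v
matching-•⁻ π@(diag (suc k) t b) ρ@(diag (suc l) u v) m with labels-• t b u v
... | r , labels≡ = matching-⊗⁻ π ρ (atMostTwice⇒matching (π ⊗ ρ)
  (atMostTwice-map⁻ r (labels (π ⊗ ρ)) (subst AtMostTwice labels≡ (matching⇒atMostTwice (π • ρ) m))))

Consistent : List (ℕ × ℕ) → Set
Consistent ps = ∀ {a a' b b'} → (a , a') ∈ ps → (b , b') ∈ ps → (a ≡ᵇ b) ≡ (a' ≡ᵇ b')

sameRel-sound : ∀ ps → T (sameRel ps) → Consistent ps
sameRel-sound ps h {a} {a'} {b} {b'} ma mb
  with a ≡ᵇ b | a' ≡ᵇ b' | All.lookup (all⁺ _ ps (All.lookup (all⁺ _ ps h) ma)) mb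
... | true  | true  | _ = refl
... | false | false | _ = refl

-- By contradiction, because the comparison local to sameRel cannot be named here: with-abstraction
-- evaluates it on a failing entry, which exhibits two pairs that break consistency.
sameRel-complete : ∀ ps → Consistent ps → T (sameRel ps)
sameRel-complete ps c with T? (sameRel ps)
... | yes h = h
... | no ¬h with find (¬All⇒Any¬ (T? ∘ _) ps (¬h ∘ all⁻ _))
...   | (a , a') , ma , ¬row with find (¬All⇒Any¬ (T? ∘ _) ps (¬row ∘ all⁻ _))
...     | (b , b') , mb , ¬entry with a ≡ᵇ b | a' ≡ᵇ b' | c ma mb | ¬entry
...       | true  | true  | _ | ¬e = ⊥-elim (¬e _)
...       | false | false | _ | ¬e = ⊥-elim (¬e _)

Relabelling : List ℕ → List ℕ → Set
Relabelling xs ys = Σ (ℕ → ℕ) λ f → Σ (ℕ → ℕ) λ g → map f xs ≡ ys × map g ys ≡ xs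

partner : List (ℕ × ℕ) → ℕ → ℕ
partner []              a = 0
partner ((b , b') ∷ ps) a = if a ≡ᵇ b then b' else partner ps a

partner-∈ : ∀ {qs} → Consistent qs → ∀ ps → ps ⊆ qs → ∀ {a a'} → (a , a') ∈ ps →
            partner ps a ≡ a'
partner-∈ c ((b , b') ∷ ps) ps⊆qs {a} {a'} m with a ≡ᵇ b in e | m
... | true  | _          = sym (≡ᵇ-sound (trans (sym (c (ps⊆qs m) (ps⊆qs (here refl)))) e))
... | false | here refl  = case trans (sym (≡ᵇ-complete {a} refl)) e of λ ()
... | false | there m'   = partner-∈ c ps (ps⊆qs ∘ there) m'

map-partner : ∀ {qs} → Consistent qs → ∀ xs ys → length xs ≡ length ys → zip xs ys ⊆ qs →
              map (partner qs) xs ≡ ys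
map-partner c []       []       _   _      = refl
map-partner c (x ∷ xs) (y ∷ ys) len zip⊆qs =
  cong₂ _∷_ (partner-∈ c _ id (zip⊆qs (here refl))) (map-partner c xs ys (suc-injective len) (zip⊆qs ∘ there))

∈-zip-swap : ∀ {a b : ℕ} xs ys → (a , b) ∈ zip xs ys → (b , a) ∈ zip ys xs
∈-zip-swap (x ∷ xs) (y ∷ ys) (here refl) = here refl
∈-zip-swap (x ∷ xs) (y ∷ ys) (there m)   = there (∈-zip-swap xs ys m)

∈-zip-relabelled : ∀ {f g : ℕ → ℕ} xs ys → map f xs ≡ ys → map g ys ≡ xs →
                   ∀ {a a'} → (a , a') ∈ zip xs ys → a' ≡ f a × a ≡ g a'
∈-zip-relabelled (x ∷ xs) (y ∷ ys) p q (here refl) =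
  sym (proj₁ (∷-injective p)) , sym (proj₁ (∷-injective q))
∈-zip-relabelled (x ∷ xs) (y ∷ ys) p q (there m)   =
  ∈-zip-relabelled xs ys (proj₂ (∷-injective p)) (proj₂ (∷-injective q)) m

consistent⇒relabelling : ∀ xs ys → length xs ≡ length ys → Consistent (zip xs ys) → Relabelling xs ys
consistent⇒relabelling xs ys len c =
  partner (zip xs ys) , partner (zip ys xs) ,
  map-partner c xs ys len id , map-partner c' ys xs (sym len) id
  where
  c' : Consistent (zip ys xs)
  c' ma mb = sym (c (∈-zip-swap ys xs ma) (∈-zip-swap ys xs mb))

relabelling⇒consistent : ∀ xs ys → Relabelling xs ys → Consistent (zip xs ys)
relabelling⇒consistent xs ys (f , g , p , q) ma mb
  with ∈-zip-relabelled xs ys p q ma | ∈-zip-relabelled xs ys p q mb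
... | a'≡fa , a≡ga' | b'≡fb , b≡gb' =
  ≡ᵇ-cong (λ a≡b → trans a'≡fa (trans (cong f a≡b) (sym b'≡fb)))
          (λ a'≡b' → trans a≡ga' (trans (cong g a'≡b') (sym b≡gb')))

relabelling-refl : ∀ xs → Relabelling xs xs
relabelling-refl xs = id , id , map-id xs , map-id xs

relabelling-sym : ∀ {xs ys} → Relabelling xs ys → Relabelling ys xs
relabelling-sym (f , g , p , q) = g , f , q , p

relabelling-trans : ∀ {xs ys zs} → Relabelling xs ys → Relabelling ys zs → Relabelling xs zs
relabelling-trans {xs} {ys} {zs} (f , g , p , q) (f' , g' , p' , q') =
  f' ∘ f , g ∘ g' , trans (map-∘ xs) (trans (cong (map f') p) p')
                  , trans (map-∘ zs) (trans (cong (map g) q') q)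

length-labels : ∀ π → length (labels π) ≡ order π + order π
length-labels (diag k t b) = trans (length-++ (toList t)) (cong₂ _+_ (length-toList t) (length-toList b))

record _≃_ (π ρ : Diagram) : Set where
  constructor from-≐
  field to-≐ : π ≐ ρ ≡ true

≃⇒relabelling : ∀ {π ρ} → π ≃ ρ → order π ≡ order ρ × Relabelling (labels π) (labels ρ)
≃⇒relabelling {π} {ρ} (from-≐ π≐ρ) with Equivalence.to T-∧ (Equivalence.from T-≡ π≐ρ)
... | orders , same = k≡l , consistent⇒relabelling (labels π) (labels ρ) lengths (sameRel-sound _ same)
  where
  k≡l = ≡ᵇ⇒≡ (order π) (order ρ) orders
  lengths = trans (length-labels π) (trans (cong₂ _+_ k≡l k≡l) (sym (length-labels ρ)))

relabelling⇒≃ : ∀ {π ρ} → order π ≡ order ρ → Relabelling (labels π) (labels ρ) → π ≃ ρ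
relabelling⇒≃ {π} {ρ} k≡l r = from-≐ (Equivalence.to T-≡ (Equivalence.from T-∧
  (≡⇒≡ᵇ (order π) (order ρ) k≡l , sameRel-complete _ (relabelling⇒consistent (labels π) (labels ρ) r))))

≃-order : ∀ {π ρ} → π ≃ ρ → order π ≡ order ρ
≃-order = proj₁ ∘ ≃⇒relabelling

≃-isEquivalence : IsEquivalence _≃_
≃-isEquivalence = record
  { refl  = λ {π} → relabelling⇒≃ refl (relabelling-refl (labels π))
  ; sym   = λ π≃ρ → let k≡l , r = ≃⇒relabelling π≃ρ in
                      relabelling⇒≃ (sym k≡l) (relabelling-sym r)
  ; trans = λ π≃ρ ρ≃σ → let k≡l , r = ≃⇒relabelling π≃ρ ; l≡m , r' = ≃⇒relabelling ρ≃σ in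
                        relabelling⇒≃ (trans k≡l l≡m) (relabelling-trans r r')
  }

≃-isBooleanEquivalence : IsBooleanEquivalence _≃_ _≐_
≃-isBooleanEquivalence = record
  { isEquivalence = ≃-isEquivalence ; sound = from-≐ ; complete = _≃_.to-≐ }

open IsBooleanEquivalence ≃-isBooleanEquivalence
  using () renaming (∼-refl to ≃-refl; ∼-sym to ≃-sym; ∼ᵇ-congˡ to ≐-congˡ; ∼ᵇ-congʳ to ≐-congʳ)

matching-≃ : ∀ {π ρ} → π ≃ ρ → Matching π → Matching ρ
matching-≃ {π} {ρ} π≃ρ m with ≃⇒relabelling π≃ρ
... | _ , f , g , p , q = atMostTwice⇒matching ρ
  (atMostTwice-map⁻ g (labels ρ) (subst AtMostTwice (sym q) (matching⇒atMostTwice π m)))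

++-injective : ∀ (xs ys : List ℕ) {xs' ys'} → length xs ≡ length ys → xs ++ xs' ≡ ys ++ ys' →
               xs ≡ ys × xs' ≡ ys'
++-injective []       []       _   e = refl , e
++-injective (x ∷ xs) (y ∷ ys) len e with ∷-injective e
... | x≡y , e' with ++-injective xs ys (suc-injective len) e'
...   | xs≡ys , xs'≡ys' = cong₂ _∷_ x≡y xs≡ys , xs'≡ys'

map-labels⁻ : ∀ (f : ℕ → ℕ) π π' → order π ≡ order π' → map f (labels π) ≡ labels π' →
  map f (toList (top π)) ≡ toList (top π') × map f (toList (bot π)) ≡ toList (bot π')
map-labels⁻ f (diag k t b) (diag .k t' b') refl p =
  ++-injective (map f (toList t)) (toList t')
    (trans (length-map f (toList t)) (trans (length-toList t) (sym (length-toList t'))))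
    (trans (sym (map-++ f (toList t) (toList b))) p)

juxtapose : ℕ → ℕ → (ℕ → ℕ) → (ℕ → ℕ) → ℕ → ℕ
juxtapose N N' f g x with x <? N
... | yes _ = f x
... | no  _ = N' + g (x ∸ N)

map-juxtapose : ∀ {N N'} (f g : ℕ → ℕ) xs ys → All (_< N) xs →
  map (juxtapose N N' f g) (xs ++ map (N +_) ys) ≡ map f xs ++ map (N' +_) (map g ys)
map-juxtapose         f g []       []       []           = refl
map-juxtapose {N} {N'} f g []       (y ∷ ys) []           with N + y <? N
... | yes N+y<N = contradiction N+y<N (m+n≮m N y)
... | no _      = cong₂ _∷_ (cong (λ z → N' + g z) (m+n∸m≡n N y)) (map-juxtapose f g [] ys [])
map-juxtapose {N}      f g (x ∷ xs) ys       (x<N ∷ xs<N) with x <? N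
... | yes _     = cong (f x ∷_) (map-juxtapose f g xs ys xs<N)
... | no x≮N    = contradiction x<N x≮N

relabelling-⊗ : ∀ {f g : ℕ → ℕ} π π' ρ ρ' → order π ≡ order π' → order ρ ≡ order ρ' →
  map f (labels π) ≡ labels π' → map g (labels ρ) ≡ labels ρ' →
  map (juxtapose (fresh π) (fresh π') f g) (labels (π ⊗ ρ)) ≡ labels (π' ⊗ ρ')
relabelling-⊗ {f} {g} π π' ρ ρ' k≡k' l≡l' p q = begin
  map j (labels (π ⊗ ρ))                               ≡⟨ cong (map j) (labels-⊗ π ρ) ⟩
  map j ((t ++ S u) ++ (b ++ S v))                     ≡⟨ map-++ j (t ++ S u) _ ⟩
  map j (t ++ S u) ++ map j (b ++ S v)
    ≡⟨ cong₂ _++_ (map-juxtapose f g t u (++⁻ˡ t (labels<fresh π)))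
                  (map-juxtapose f g b v (++⁻ʳ t (labels<fresh π))) ⟩
  (map f t ++ S' (map g u)) ++ (map f b ++ S' (map g v))
    ≡⟨ cong₂ _++_ (cong₂ _++_ t≡ (cong S' u≡)) (cong₂ _++_ b≡ (cong S' v≡)) ⟩
  (t' ++ S' u') ++ (b' ++ S' v')                       ≡⟨ labels-⊗ π' ρ' ⟨
  labels (π' ⊗ ρ')                                     ∎
  where
  open ≡-Reasoning
  j  = juxtapose (fresh π) (fresh π') f g
  S  = map (fresh π +_)
  S' = map (fresh π' +_)
  t  = toList (top π)
  b  = toList (bot π)
  u  = toList (top ρ)
  v  = toList (bot ρ)
  t' = toList (top π')
  b' = toList (bot π')
  u' = toList (top ρ')
  v' = toList (bot ρ')
  t≡ = proj₁ (map-labels⁻ f π π' k≡k' p)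
  b≡ = proj₂ (map-labels⁻ f π π' k≡k' p)
  u≡ = proj₁ (map-labels⁻ g ρ ρ' l≡l' q)
  v≡ = proj₂ (map-labels⁻ g ρ ρ' l≡l' q)

⊗-cong : ∀ {π π' ρ ρ'} → π ≃ π' → ρ ≃ ρ' → (π ⊗ ρ) ≃ (π' ⊗ ρ')
⊗-cong {π} {π'} {ρ} {ρ'} π≃π' ρ≃ρ'
  with ≃⇒relabelling π≃π' | ≃⇒relabelling ρ≃ρ'
... | k≡k' , f , f⁻ , p , p⁻ | l≡l' , g , g⁻ , q , q⁻ = relabelling⇒≃ (cong₂ _+_ k≡k' l≡l')
  ( juxtapose (fresh π) (fresh π') f g , juxtapose (fresh π') (fresh π) f⁻ g⁻
  , relabelling-⊗ π π' ρ ρ' k≡k' l≡l' p q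
  , relabelling-⊗ π' π ρ' ρ (sym k≡k') (sym l≡l') p⁻ q⁻ )

splitsAt : Diagram → ℕ → List (Diagram × Diagram)
splitsAt π j = concatMap (λ ρ₁ → concatMap (λ ρ₂ → if (ρ₁ ⊗ ρ₂) ≐ π then (ρ₁ , ρ₂) ∷ [] else [])
                                           (diagrams (order π ∸ suc j)))
                         (diagrams (suc j))

factorsFrom : ℕ → Diagram → List ℕ → List Diagram
factorsFrom f π []       = π ∷ []
factorsFrom f π (j ∷ js) with splitsAt π j
... | []            = factorsFrom f π js
... | (ρ₁ , ρ₂) ∷ _ = ρ₁ ∷ factorsF f ρ₂

mutual
  factorsF-unfold : ∀ f π → factorsF (suc f) π ≡ factorsFrom f π (upTo (order π ∸ 1))
  factorsF-unfold f π with upTo (order π ∸ 1)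
  ... | js = factorsF-go f π js

  -- The left-hand side is the local function go of factorsF, which cannot be named outside Defs;
  -- Agda infers it from the use in factorsF-unfold.
  factorsF-go : ∀ f π js → _ ≡ factorsFrom f π js
  factorsF-go f π []       = refl
  factorsF-go f π (j ∷ js) with splitsAt π j
  ... | []    = factorsF-go f π js
  ... | _ ∷ _ = refl

splitsAt-≃ : ∀ π j → All (λ ρs → (proj₁ ρs ⊗ proj₂ ρs) ≃ π) (splitsAt π j)
splitsAt-≃ π j = All-concatMap _ (λ ρ₁ → All-concatMap _ (λ ρ₂ →
  All-guarded ((ρ₁ ⊗ ρ₂) ≐ π) (ρ₁ , ρ₂) from-≐)
  (diagrams (order π ∸ suc j))) (diagrams (suc j))

splitsAt-resp : ∀ {π π'} j → π ≃ π' → splitsAt π j ≡ splitsAt π' j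
splitsAt-resp {diag k _ _} {diag k' _ _} j π≃π' with refl ← ≃-order π≃π' =
  concatMap-cong (λ ρ₁ → concatMap-cong (λ ρ₂ →
    cong (λ c → if c then (ρ₁ , ρ₂) ∷ [] else []) (≐-congʳ (ρ₁ ⊗ ρ₂) π≃π'))
    (diagrams (k ∸ suc j))) (diagrams (suc j))

factorsF-matching : ∀ f π → Matching π → All Matching (factorsF f π)
factorsF-matching zero    π m = []
factorsF-matching (suc f) π m rewrite factorsF-unfold f π = from (upTo (order π ∸ 1))
  where
  from : ∀ js → All Matching (factorsFrom f π js)
  from []       = m ∷ []
  from (j ∷ js) with splitsAt π j | splitsAt-≃ π j
  ... | []            | _            = from js
  ... | (ρ₁ , ρ₂) ∷ _ | ρ₁⊗ρ₂≃π ∷ _ =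
    let m₁ , m₂ = matching-⊗⁻ ρ₁ ρ₂ (matching-≃ (≃-sym ρ₁⊗ρ₂≃π) m)
    in m₁ ∷ factorsF-matching f ρ₂ m₂

factors-matching : ∀ π → Matching π → All Matching (factors π)
factors-matching π = factorsF-matching (order π) π

module _ {x} {X : Set x} (D : Diagram → X) (D-resp : ∀ {π π'} → π ≃ π' → D π ≡ D π') where

  map-factorsF-resp : ∀ f {π π'} → π ≃ π' → map D (factorsF f π) ≡ map D (factorsF f π')
  map-factorsF-resp zero    π≃π' = refl
  map-factorsF-resp (suc f) {π} {π'} π≃π'
    rewrite factorsF-unfold f π | factorsF-unfold f π' | ≃-order π≃π' = from (upTo (order π' ∸ 1))
    where
    from : ∀ js → map D (factorsFrom f π js) ≡ map D (factorsFrom f π' js)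
    from []       = cong (_∷ []) (D-resp π≃π')
    from (j ∷ js) rewrite splitsAt-resp j π≃π' with splitsAt π' j
    ... | []    = from js
    ... | _ ∷ _ = refl

  map-factors-resp : ∀ {π π'} → π ≃ π' → map D (factors π) ≡ map D (factors π')
  map-factors-resp {π} π≃π' rewrite sym (≃-order π≃π') = map-factorsF-resp (order π) π≃π'

matching-foldr-•⁻ : ∀ ρs → Matching (foldr _•_ ∅ ρs) → All Matching ρs
matching-foldr-•⁻ []       m = []
matching-foldr-•⁻ (ρ ∷ ρs) m with matching-•⁻ ρ (foldr _•_ ∅ ρs) m
... | mρ , mρs = mρ ∷ matching-foldr-•⁻ ρs mρs

matching-foldr-⊗⁺ : ∀ {ρs} → All Matching ρs → Matching (foldr _⊗_ ∅ ρs)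
matching-foldr-⊗⁺            []          = []
matching-foldr-⊗⁺ {ρ ∷ ρs} (mρ ∷ mρs) = matching-⊗⁺ ρ _ mρ (matching-foldr-⊗⁺ mρs)

MatchingPair : Diagram × Diagram → Set
MatchingPair (σ , τ) = Matching σ × Matching τ

_≃₂_ : Diagram × Diagram → Diagram × Diagram → Set
_≃₂_ = Pointwise _≃_ _≃_

_≐₂_ : Diagram × Diagram → Diagram × Diagram → Bool
(π , ρ) ≐₂ (σ , τ) = (π ≐ σ) ∧ (ρ ≐ τ)

≃₂-isBooleanEquivalence : IsBooleanEquivalence _≃₂_ _≐₂_
≃₂-isBooleanEquivalence = record
  { isEquivalence = ×-isEquivalence ≃-isEquivalence ≃-isEquivalence
  ; sound         = λ { {π , ρ} {σ , τ} e → from-≐ (∧-conicalˡ (π ≐ σ) (ρ ≐ τ) e)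
                                            , from-≐ (∧-conicalʳ (π ≐ σ) (ρ ≐ τ) e) }
  ; complete      = λ { (π≃σ , ρ≃τ) → cong₂ _∧_ (_≃_.to-≐ π≃σ) (_≃_.to-≐ ρ≃τ) }
  }

matchingPair-≃₂ : ∀ {πρ στ} → πρ ≃₂ στ → MatchingPair πρ → MatchingPair στ
matchingPair-≃₂ (π≃σ , ρ≃τ) (mπ , mρ) = matching-≃ π≃σ mπ , matching-≃ ρ≃τ mρ

module _ {c ℓ} (𝕜 : Field c ℓ) where
  open ParSym 𝕜
  open Field 𝕜 using (Carrier; semiring; _≈_; 0#; 1#) renaming (trans to ≈-trans; reflexive to ≈-reflexive)
  open LinearCombinations semiring
  open Span ≃-isBooleanEquivalence using (weightedSum-inSpan)

  Δgen-supported : ∀ ρ → Matching ρ → SupportedOn MatchingPair (Δgen ρ)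
  Δgen-supported ρ m = All-concatMap _ (λ j → All-concatMap _ (λ G₁ → All-concatMap _ (λ G₂ →
    All-guarded _ (1# , G₁ , G₂) λ guard →
      matching-•⁻ G₁ G₂ (matching-≃ (≃-sym (•≃ρ G₁ G₂ guard)) m))
    (diagrams (order ρ ∸ j))) (diagrams j)) (upTo (suc (order ρ)))
    where
    •≃ρ : ∀ G₁ G₂ → (isEmpty G₁ ∨ irreducible G₁) ∧ (isEmpty G₂ ∨ irreducible G₂) ∧ ((G₁ • G₂) ≐ ρ)
                      ≡ true →
          (G₁ • G₂) ≃ ρ
    •≃ρ G₁ G₂ guard = from-≐ (∧-conicalʳ (isEmpty G₂ ∨ irreducible G₂) _
                               (∧-conicalʳ (isEmpty G₁ ∨ irreducible G₁) _ guard))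

  Sgen-supported : ∀ ρ → Matching ρ → SupportedOn Matching (Sgen ρ)
  Sgen-supported ρ m = All-concatMap _ (λ comp → All-concatMap _ (λ ρs →
    All-guarded _ (sign (length ρs) , foldr _⊗_ ∅ ρs) λ guard →
      let mρs = matching-foldr-•⁻ ρs (matching-≃ (≃-sym (from-≐ {foldr _•_ ∅ ρs} {ρ} guard)) m)
      in matching-foldr-⊗⁺ mρs)
    (tuples comp)) (compositions (order ρ))

  Δgen-resp : ∀ {π π'} → π ≃ π' → Δgen π ≡ Δgen π'
  Δgen-resp {diag k _ _} {diag k' _ _} π≃π' with refl ← ≃-order π≃π' =
    concatMap-cong (λ j → concatMap-cong (λ G₁ → concatMap-cong (λ G₂ →
      cong (λ c → if (isEmpty G₁ ∨ irreducible G₁) ∧ (isEmpty G₂ ∨ irreducible G₂) ∧ c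
                  then (1# , G₁ , G₂) ∷ [] else [])
           (≐-congʳ (G₁ • G₂) π≃π'))
      (diagrams (k ∸ j))) (diagrams j)) (upTo (suc k))

  Sgen-resp : ∀ {π π'} → π ≃ π' → Sgen π ≡ Sgen π'
  Sgen-resp {diag k _ _} {diag k' _ _} π≃π' with refl ← ≃-order π≃π' =
    concatMap-cong (λ comp → concatMap-cong (λ ρs →
      cong (λ c → if c then (sign (length ρs) , foldr _⊗_ ∅ ρs) ∷ [] else [])
           (≐-congʳ (foldr _•_ ∅ ρs) π≃π'))
      (tuples comp)) (compositions k)

  ΔH-supported : ∀ π → Matching π → SupportedOn MatchingPair (ΔH π)
  ΔH-supported π m = go (factors-matching π m)
    where
    go : ∀ {ρs} → All Matching ρs →
         SupportedOn MatchingPair (foldr (λ ρ acc → Δgen ρ ·₂ acc) ((1# , ∅ , ∅) ∷ []) ρs)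
    go []                   = ([] , []) ∷ []
    go {ρ ∷ ρs} (mρ ∷ mρs) = expand-supported _ _
      (λ { {σ , σ'} {τ , τ'} (mσ , mσ') (mτ , mτ') → matching-⊗⁺ σ τ mσ mτ , matching-⊗⁺ σ' τ' mσ' mτ' })
      (λ _ _ → go mρs) (Δgen ρ) (Δgen-supported ρ mρ)

  SH-supported : ∀ π → Matching π → SupportedOn Matching (SH π)
  SH-supported π m = go (factors-matching π m)
    where
    go : ∀ {ρs} → All Matching ρs → SupportedOn Matching (foldr (λ ρ acc → acc · Sgen ρ) (H ∅) ρs)
    go []                   = [] ∷ []
    go {ρ ∷ ρs} (mρ ∷ mρs) =
      expand-supported _ _ (λ {σ} {τ} → matching-⊗⁺ σ τ) (λ _ _ → Sgen-supported ρ mρ) _ (go mρs)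

  ΔH-resp : ∀ {π π'} → π ≃ π' → ΔH π ≡ ΔH π'
  ΔH-resp {π} {π'} π≃π' = begin
    ΔH π                                     ≡⟨ foldr-map _·₂_ Δgen unit (factors π) ⟨
    foldr _·₂_ unit (map Δgen (factors π))
      ≡⟨ cong (foldr _·₂_ unit) (map-factors-resp Δgen Δgen-resp π≃π') ⟩
    foldr _·₂_ unit (map Δgen (factors π'))  ≡⟨ foldr-map _·₂_ Δgen unit (factors π') ⟩
    ΔH π'                                    ∎
    where
    open ≡-Reasoning
    unit = (1# , ∅ , ∅) ∷ []

  SH-resp : ∀ {π π'} → π ≃ π' → SH π ≡ SH π'
  SH-resp {π} {π'} π≃π' = begin
    SH π                                       ≡⟨ foldr-map _·ᵒᵖ_ Sgen (H ∅) (factors π) ⟨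
    foldr _·ᵒᵖ_ (H ∅) (map Sgen (factors π))
      ≡⟨ cong (foldr _·ᵒᵖ_ (H ∅)) (map-factors-resp Sgen Sgen-resp π≃π') ⟩
    foldr _·ᵒᵖ_ (H ∅) (map Sgen (factors π'))  ≡⟨ foldr-map _·ᵒᵖ_ Sgen (H ∅) (factors π') ⟩
    SH π'                                      ∎
    where
    open ≡-Reasoning
    _·ᵒᵖ_ : PS → PS → PS
    y ·ᵒᵖ x = x · y

  unit-inSpan : InMatchingSpan (H ∅)
  unit-inSpan σ = coeff-supported ≃-isBooleanEquivalence matching-≃ (H ∅) σ ([] ∷ [])

  product-inSpan : ∀ x y → InMatchingSpan x → InMatchingSpan y → InMatchingSpan (x · y)
  product-inSpan x y x∈ y∈ σ ¬mσ =
    ≈-trans (coeff-expand _≐_ (λ _ → y) _⊗_ x σ) (weightedSum-inSpan matching? F F-resp F≈0 x x∈)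
    where
    G : Diagram → Diagram → Carrier
    G π ρ = indicator ((π ⊗ ρ) ≐ σ)
    G-resp : ∀ {π π' ρ ρ'} → π ≃ π' → ρ ≃ ρ' → G π ρ ≈ G π' ρ'
    G-resp π≃π' ρ≃ρ' = ≈-reflexive (cong indicator (≐-congˡ σ (⊗-cong π≃π' ρ≃ρ')))
    F : Diagram → Carrier
    F π = weightedSum (G π) y
    F-resp : ∀ {π π'} → π ≃ π' → F π ≈ F π'
    F-resp π≃π' = weightedSum-cong (λ ρ → G-resp π≃π' (≃-refl {ρ})) y
    F≈0 : ∀ π → Matching π → F π ≈ 0#
    F≈0 π mπ = weightedSum-inSpan matching? (G π) (G-resp (≃-refl {π}))
      (λ ρ mρ → indicator-vanishes ≃-isBooleanEquivalence matching-≃ σ ¬mσ (π ⊗ ρ)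
                                    (matching-⊗⁺ π ρ mπ mρ))
      y y∈

  expand-inSpan : ∀ {B : Set} {_∼_ : B → B → Set} {_∼ᵇ_ : B → B → Bool} {P : B → Set} →
    IsBooleanEquivalence _∼_ _∼ᵇ_ → (∀ {π σ} → π ∼ σ → P π → P σ) →
    (F : Diagram → Combination B) → (∀ {π π'} → π ≃ π' → F π ≡ F π') →
    (∀ π → Matching π → SupportedOn P (F π)) →
    ∀ x → InMatchingSpan x → ∀ σ → ¬ P σ → coeffWith _∼ᵇ_ (expand F (λ _ ρ → ρ) x) σ ≈ 0#
  expand-inSpan {_∼ᵇ_ = _∼ᵇ_} isBoolEq P-resp F F-resp F-supported x x∈ σ ¬Pσ =
    ≈-trans (coeff-expand _∼ᵇ_ F (λ _ ρ → ρ) x σ)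
      (weightedSum-inSpan matching? _ (≈-reflexive ∘ cong (weightedSum _) ∘ F-resp)
         (λ π mπ → weightedSum-supported _ (indicator-vanishes isBoolEq P-resp σ ¬Pσ) (F π) (F-supported π mπ))
         x x∈)

  coproduct-inSpan : ∀ x → InMatchingSpan x → InMatchingSpan² (Δ x)
  coproduct-inSpan x x∈ σ τ =
    expand-inSpan ≃₂-isBooleanEquivalence matchingPair-≃₂ ΔH ΔH-resp ΔH-supported x x∈ (σ , τ)

  antipode-inSpan : ∀ x → InMatchingSpan x → InMatchingSpan (S x)
  antipode-inSpan = expand-inSpan ≃-isBooleanEquivalence matching-≃ SH SH-resp SH-supported

theorem4p2 : {c ℓ : Level} (𝕜 : Field c ℓ) → let open ParSym 𝕜 in
    InMatchingSpan (H ∅)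
    × (∀ x y → InMatchingSpan x → InMatchingSpan y → InMatchingSpan (x · y))
    × (∀ x → InMatchingSpan x → InMatchingSpan² (Δ x))
    × (∀ x → InMatchingSpan x → InMatchingSpan (S x))
theorem4p2 𝕜 = unit-inSpan 𝕜 , product-inSpan 𝕜 , coproduct-inSpan 𝕜 , antipode-inSpan 𝕜
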